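{- Let $(c_n)_{n\ge0}$ and $(d_n)_{n\ge0}$ be sequences of complex numbers satisfying $d_n=\sum_{i=0}^n\binom ni c_i$ for all $n\ge0$. Then for all complex numbers $a,b$ and all nonnegative integers $n$, \begin{gather*} \sum_{i=0}^n\binom ai\binom b{n-i}d_i=\sum_{j=0}^n\binom aj\binom{a+b-j}{n-j}c_j,\\ \sum_{i=0}^n\binom ai\binom{2a-2i}{n-i}(-2)^id_i=\sum_{j=0}^{\lfloor n/2\rfloor}\binom a{n-j}\binom{n-j}j(-2)^{n-2j}c_{n-2j},\\ \sum_{i=0}^n\binom ai\binom{2a-2i}{n-i}(-4)^id_i=(-1)^n\sum_{j=0}^n\binom aj\binom{2a-2j}{n-j}4^jc_j. \end{gather*}
   Context: For complex $a$ and integer $k\ge0$, $\binom ak=a(a-1)\cdots(a-k+1)/k!$. -}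

module Defs where

open import Level using (_⊔_)
open import Data.Nat as ℕ using (ℕ; zero; suc; _∸_; ⌊_/2⌋)
open import Algebra.Bundles using (CommutativeRing)

-- A commutative Q-algebra: a commutative cring in which every positive
-- integer is invertible.  The complex numbers are such a cring (ℂ is not
-- available in agda-stdlib).
-- canonical image of a natural number: ι n = 1 + 1 + ... + 1
natEmbed : ∀ {c ℓ} (R : CommutativeRing c ℓ) → ℕ → CommutativeRing.Carrier R
natEmbed R zero = CommutativeRing.0# R
natEmbed R (suc n) = CommutativeRing._+_ R (CommutativeRing.1# R) (natEmbed R n)

record QAlgebra c ℓ : Set (Level.suc (c ⊔ ℓ)) where
  field
    cring : CommutativeRing c ℓ
  open CommutativeRing cring
  field
    invPos : ℕ → Carrier
    invPos-inverse : ∀ n → natEmbed cring (suc n) * invPos n ≈ 1#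

module QOps {c ℓ} (Q : QAlgebra c ℓ) where
  open QAlgebra Q public
  open CommutativeRing cring public hiding (zero)

  ι : ℕ → Carrier
  ι = natEmbed cring

  sumTo : ℕ → (ℕ → Carrier) → Carrier
  sumTo zero f = f zero
  sumTo (suc n) f = sumTo n f + f (suc n)

  pow : Carrier → ℕ → Carrier
  pow x zero = 1#
  pow x (suc k) = pow x k * x

  falling : Carrier → ℕ → Carrier
  falling a zero = 1#
  falling a (suc k) = falling a k * (a - ι k)

  invFact : ℕ → Carrier
  invFact zero = 1#
  invFact (suc k) = invFact k * invPos k

  binom : Carrier → ℕ → Carrier
  binom a k = falling a k * invFact k

{-# OPTIONS --safe #-}
-- Substituting d_i = Σ_k C(i,k) c_k and using C(a,k+l) C(k+l,k) = C(a,k) C(a-k,l), each left-hand side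
-- becomes Σ_k C(a,k) c_k times an inner sum over l.  In the first identity the inner sum is Vandermonde's
-- convolution.  In the other two it is s^k T_s(a-k, n-k), where T_s(x,m) is the coefficient of t^m in
-- ((1+t)^2 + s t)^x, which is (1-t)^(2x) for s = -4 and (1+t^2)^x for s = -2.  Instead of power series,
-- these closed forms are proved by induction on m from the coefficient form of
-- d/dt ((1+t)^2 + s t)^x = x (s + 2 + 2t) ((1+t)^2 + s t)^(x-1), namely
--   (m+1) T_s(x, m+1) = (s+2) x T_s(x-1, m) + 2 x T_s(x-1, m-1),
-- which follows from the absorption identity (k+1) C(x,k+1) = x C(x-1,k) and Pascal's rule; the same
-- argument proves Vandermonde.  Division by m+1 is where the Q-algebra structure is needed.
module Submission where

open import Defs
open import Data.Nat using (ℕ; _∸_; ⌊_/2⌋)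
open import Data.Nat as N using ()
open import Data.Product using (_×_)

open import Data.Nat using (zero; suc)
open import Data.Integer as ℤ using (ℤ; +_; -[1+_]; sign; ∣_∣; _◃_; _⊖_)
open import Data.Integer.Properties using ([1+m]⊖[1+n]≡m⊖n)
import Data.Nat.Properties as NP
open import Data.Maybe using (Maybe; just; nothing)
open import Data.Sum using (_⊎_; inj₁; inj₂)
open import Data.Product using (_,_)
open import Data.Sign as Sign using (Sign)
open import Relation.Nullary using (yes; no)
open import Relation.Binary.PropositionalEquality as ≡ using (_≡_)
open import Algebra.Bundles using (CommutativeRing)
open import Algebra.Solver.Ring.AlmostCommutativeRing using (_-Raw-AlmostCommutative⟶_; fromCommutativeRing)

module IntegerCoefficients {c ℓ} (R : CommutativeRing c ℓ) where
  open CommutativeRing R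
  open import Algebra.Properties.Ring ring using (-0#≈0#; -1*x≈-x; -‿involutive; -‿+-comm)
  open import Algebra.Properties.CommutativeSemigroup +-commutativeSemigroup using () renaming (interchange to +-interchange)
  open import Algebra.Properties.CommutativeSemigroup *-commutativeSemigroup using () renaming (interchange to *-interchange)
  open import Relation.Binary.Reasoning.Setoid setoid

  ι : ℕ → Carrier
  ι = natEmbed R

  ι-+ : ∀ m n → ι (m N.+ n) ≈ ι m + ι n
  ι-+ zero n = sym (+-identityˡ _)
  ι-+ (suc m) n = trans (+-congˡ (ι-+ m n)) (sym (+-assoc _ _ _))

  ι-* : ∀ m n → ι (m N.* n) ≈ ι m * ι n
  ι-* zero n = sym (zeroˡ _)
  ι-* (suc m) n = begin
    ι (n N.+ m N.* n)        ≈⟨ ι-+ n (m N.* n) ⟩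
    ι n + ι (m N.* n)        ≈⟨ +-congˡ (ι-* m n) ⟩
    ι n + ι m * ι n          ≈⟨ +-congʳ (*-identityˡ _) ⟨
    1# * ι n + ι m * ι n     ≈⟨ distribʳ _ _ _ ⟨
    (1# + ι m) * ι n         ∎

  intEmbed : ℤ → Carrier
  intEmbed (+ n) = ι n
  intEmbed -[1+ n ] = - ι (suc n)

  ⟦_⟧ₛ : Sign → Carrier
  ⟦ Sign.+ ⟧ₛ = 1#
  ⟦ Sign.- ⟧ₛ = - 1#

  ◃-homo : ∀ s n → intEmbed (s ◃ n) ≈ ⟦ s ⟧ₛ * ι n
  ◃-homo s zero = sym (zeroʳ _)
  ◃-homo Sign.+ (suc n) = sym (*-identityˡ _)
  ◃-homo Sign.- (suc n) = sym (-1*x≈-x _)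

  sign-abs : ∀ i → intEmbed i ≈ ⟦ sign i ⟧ₛ * ι ∣ i ∣
  sign-abs (+ n) = sym (*-identityˡ _)
  sign-abs -[1+ n ] = sym (-1*x≈-x _)

  sign-*-homo : ∀ s t → ⟦ s Sign.* t ⟧ₛ ≈ ⟦ s ⟧ₛ * ⟦ t ⟧ₛ
  sign-*-homo Sign.+ t = sym (*-identityˡ _)
  sign-*-homo Sign.- Sign.+ = sym (*-identityʳ _)
  sign-*-homo Sign.- Sign.- = sym (trans (-1*x≈-x _) (-‿involutive 1#))

  ⊖-homo : ∀ m n → intEmbed (m ⊖ n) ≈ ι m - ι n
  ⊖-homo m zero = sym (trans (+-congˡ -0#≈0#) (+-identityʳ _))
  ⊖-homo zero (suc n) = sym (+-identityˡ _)
  ⊖-homo (suc m) (suc n) = begin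
    intEmbed (suc m ⊖ suc n)             ≡⟨ ≡.cong intEmbed ([1+m]⊖[1+n]≡m⊖n m n) ⟩
    intEmbed (m ⊖ n)                     ≈⟨ ⊖-homo m n ⟩
    ι m - ι n                     ≈⟨ +-identityˡ _ ⟨
    0# + (ι m - ι n)              ≈⟨ +-congʳ (-‿inverseʳ 1#) ⟨
    (1# - 1#) + (ι m - ι n)       ≈⟨ +-interchange _ _ _ _ ⟩
    (1# + ι m) + (- 1# + - ι n)   ≈⟨ +-congˡ (-‿+-comm 1# (ι n)) ⟩
    (1# + ι m) - (1# + ι n)       ∎

  +-homo : ∀ i j → intEmbed (i ℤ.+ j) ≈ intEmbed i + intEmbed j
  +-homo (+ m) (+ n) = ι-+ m n
  +-homo (+ m) -[1+ n ] = ⊖-homo m (suc n)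
  +-homo -[1+ m ] (+ n) = trans (⊖-homo n (suc m)) (+-comm _ _)
  +-homo -[1+ m ] -[1+ n ] = begin
    - ι (suc (suc (m N.+ n)))      ≡⟨ ≡.cong (λ k → - ι (suc k)) (≡.sym (NP.+-suc m n)) ⟩
    - ι (suc m N.+ suc n)          ≈⟨ -‿cong (ι-+ (suc m) (suc n)) ⟩
    - (ι (suc m) + ι (suc n))      ≈⟨ -‿+-comm _ _ ⟨
    - ι (suc m) + - ι (suc n)      ∎

  *-homo : ∀ i j → intEmbed (i ℤ.* j) ≈ intEmbed i * intEmbed j
  *-homo i j = begin
    intEmbed (sign i Sign.* sign j ◃ ∣ i ∣ N.* ∣ j ∣)               ≈⟨ ◃-homo (sign i Sign.* sign j) (∣ i ∣ N.* ∣ j ∣) ⟩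
    ⟦ sign i Sign.* sign j ⟧ₛ * ι (∣ i ∣ N.* ∣ j ∣)           ≈⟨ *-cong (sign-*-homo (sign i) (sign j)) (ι-* ∣ i ∣ ∣ j ∣) ⟩
    (⟦ sign i ⟧ₛ * ⟦ sign j ⟧ₛ) * (ι ∣ i ∣ * ι ∣ j ∣)        ≈⟨ *-interchange _ _ _ _ ⟩
    (⟦ sign i ⟧ₛ * ι ∣ i ∣) * (⟦ sign j ⟧ₛ * ι ∣ j ∣)        ≈⟨ *-cong (sign-abs i) (sign-abs j) ⟨
    intEmbed i * intEmbed j                                           ∎

  -‿homo : ∀ i → intEmbed (ℤ.- i) ≈ - intEmbed i
  -‿homo (+ zero) = sym -0#≈0#
  -‿homo (+ suc n) = refl
  -‿homo -[1+ n ] = sym (-‿involutive _)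

  -- The solver's constants must be definitionally the numerals occurring in goals (1# for + 1,
  -- not ι 1 = 1# + 0#), so it is handed ι′ rather than ι.
  ι′ : ℕ → Carrier
  ι′ 1 = 1#
  ι′ n = ι n

  ι′≈ι : ∀ n → ι′ n ≈ ι n
  ι′≈ι zero = refl
  ι′≈ι (suc zero) = sym (+-identityʳ 1#)
  ι′≈ι (suc (suc n)) = refl

  intEmbed′ : ℤ → Carrier
  intEmbed′ (+ n) = ι′ n
  intEmbed′ -[1+ n ] = - ι′ (suc n)

  intEmbed′≈intEmbed : ∀ i → intEmbed′ i ≈ intEmbed i
  intEmbed′≈intEmbed (+ n) = ι′≈ι n
  intEmbed′≈intEmbed -[1+ n ] = -‿cong (ι′≈ι (suc n))

  homomorphism : ℤ.+-*-rawRing -Raw-AlmostCommutative⟶ fromCommutativeRing R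
  homomorphism = record
    { ⟦_⟧    = intEmbed′
    ; +-homo = λ i j → transport (i ℤ.+ j) (+-homo i j) (+-cong (intEmbed′≈intEmbed i) (intEmbed′≈intEmbed j))
    ; *-homo = λ i j → transport (i ℤ.* j) (*-homo i j) (*-cong (intEmbed′≈intEmbed i) (intEmbed′≈intEmbed j))
    ; -‿homo = λ i → transport (ℤ.- i) (-‿homo i) (-‿cong (intEmbed′≈intEmbed i))
    ; 0-homo = refl
    ; 1-homo = refl
    }
    where
    transport : ∀ i {x x′} → intEmbed i ≈ x → x′ ≈ x → intEmbed′ i ≈ x′
    transport i e e′ = trans (intEmbed′≈intEmbed i) (trans e (sym e′))

  ≟-coefficients : ∀ i j → Maybe (intEmbed′ i ≈ intEmbed′ j)
  ≟-coefficients i j with i ℤ.≟ j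
  ... | yes ≡.refl = just refl
  ... | no _ = nothing

  open import Algebra.Solver.Ring ℤ.+-*-rawRing (fromCommutativeRing R) homomorphism ≟-coefficients public

  :0 :1 :2 :4 : ∀ {n} → Polynomial n
  :0 = con (+ 0)
  :1 = con (+ 1)
  :2 = con (+ 2)
  :4 = con (+ 4)

⌊n/2⌋-parity : ∀ n → n ≡ 2 N.* ⌊ n /2⌋ ⊎ n ≡ suc (2 N.* ⌊ n /2⌋)
⌊n/2⌋-parity zero = inj₁ ≡.refl
⌊n/2⌋-parity (suc zero) = inj₂ ≡.refl
⌊n/2⌋-parity (suc (suc n)) with ⌊n/2⌋-parity n
... | inj₁ e = inj₁ (≡.trans (≡.cong (2 N.+_) e) (≡.sym (NP.*-suc 2 ⌊ n /2⌋)))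
... | inj₂ e = inj₂ (≡.trans (≡.cong (2 N.+_) e) (≡.cong suc (≡.sym (NP.*-suc 2 ⌊ n /2⌋))))

2*⌊n/2⌋≤n : ∀ n → 2 N.* ⌊ n /2⌋ N.≤ n
2*⌊n/2⌋≤n n with ⌊n/2⌋-parity n
... | inj₁ n≡2h = NP.≤-reflexive (≡.sym n≡2h)
... | inj₂ n≡2h+1 = NP.≤-trans (NP.n≤1+n _) (NP.≤-reflexive (≡.sym n≡2h+1))

j+[n∸2j]≡n∸j : ∀ n j → 2 N.* j N.≤ n → j N.+ (n ∸ 2 N.* j) ≡ n ∸ j
j+[n∸2j]≡n∸j n j 2j≤n = begin
  j N.+ k                          ≡⟨ NP.m+n∸m≡n j (j N.+ k) ⟨
  j N.+ (j N.+ k) ∸ j              ≡⟨ ≡.cong (_∸ j) (NP.+-assoc j j k) ⟨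
  j N.+ j N.+ k ∸ j                ≡⟨ ≡.cong (λ i → j N.+ i N.+ k ∸ j) (NP.+-identityʳ j) ⟨
  2 N.* j N.+ k ∸ j                ≡⟨ ≡.cong (_∸ j) (NP.m+[n∸m]≡n 2j≤n) ⟩
  n ∸ j                            ∎
  where
  open ≡.≡-Reasoning
  k = n ∸ 2 N.* j

module BinomialSums {c ℓ} (Q : QAlgebra c ℓ) where
  open QOps Q
  open IntegerCoefficients cring using (ι-+; ι-*; solve; _:=_; _:+_; _:*_; _:-_; :-_; :0; :1; :2; :4)
  open import Algebra.Properties.CommutativeSemigroup +-commutativeSemigroup using () renaming (interchange to +-interchange)
  open import Relation.Binary.Reasoning.Setoid setoid

  sumTo-cong≤ : ∀ n {f g : ℕ → Carrier} → (∀ i → i N.≤ n → f i ≈ g i) → sumTo n f ≈ sumTo n g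
  sumTo-cong≤ zero f≈g = f≈g 0 N.z≤n
  sumTo-cong≤ (suc n) f≈g = +-cong (sumTo-cong≤ n (λ i i≤n → f≈g i (NP.m≤n⇒m≤1+n i≤n))) (f≈g (suc n) NP.≤-refl)

  sumTo-cong : ∀ n {f g : ℕ → Carrier} → (∀ i → f i ≈ g i) → sumTo n f ≈ sumTo n g
  sumTo-cong n f≈g = sumTo-cong≤ n (λ i _ → f≈g i)

  sumTo-+ : ∀ n (f g : ℕ → Carrier) → sumTo n (λ i → f i + g i) ≈ sumTo n f + sumTo n g
  sumTo-+ zero f g = refl
  sumTo-+ (suc n) f g = trans (+-congʳ (sumTo-+ n f g)) (+-interchange _ _ _ _)

  sumTo-*ˡ : ∀ n x (f : ℕ → Carrier) → sumTo n (λ i → x * f i) ≈ x * sumTo n f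
  sumTo-*ˡ zero x f = refl
  sumTo-*ˡ (suc n) x f = trans (+-congʳ (sumTo-*ˡ n x f)) (sym (distribˡ _ _ _))

  sumTo-sucˡ : ∀ n (f : ℕ → Carrier) → sumTo (suc n) f ≈ f 0 + sumTo n (λ i → f (suc i))
  sumTo-sucˡ zero f = refl
  sumTo-sucˡ (suc n) f = trans (+-congʳ (sumTo-sucˡ n f)) (+-assoc _ _ _)

  sumTo-reverse : ∀ n (f : ℕ → Carrier) → sumTo n f ≈ sumTo n (λ i → f (n ∸ i))
  sumTo-reverse zero f = refl
  sumTo-reverse (suc n) f = begin
    sumTo n f + f (suc n)                   ≈⟨ +-congʳ (sumTo-reverse n f) ⟩
    sumTo n (λ i → f (n ∸ i)) + f (suc n)   ≈⟨ +-comm _ _ ⟩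
    f (suc n) + sumTo n (λ i → f (n ∸ i))   ≈⟨ sumTo-sucˡ n (λ i → f (suc n ∸ i)) ⟨
    sumTo (suc n) (λ i → f (suc n ∸ i))     ∎

  sumTo-triangle : ∀ n (g : ℕ → ℕ → Carrier) →
    sumTo n (λ i → sumTo i (g i)) ≈ sumTo n (λ k → sumTo (n ∸ k) (λ l → g (k N.+ l) k))
  sumTo-triangle zero g = refl
  sumTo-triangle (suc n) g = begin
    sumTo n (λ i → sumTo i (g i)) + (sumTo n (g (suc n)) + g (suc n) (suc n))
      ≈⟨ +-congʳ (sumTo-triangle n g) ⟩
    sumTo n (column n) + (sumTo n (g (suc n)) + g (suc n) (suc n))
      ≈⟨ +-assoc _ _ _ ⟨
    (sumTo n (column n) + sumTo n (g (suc n))) + g (suc n) (suc n)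
      ≈⟨ +-congʳ (sumTo-+ n _ _) ⟨
    sumTo n (λ k → column n k + g (suc n) k) + g (suc n) (suc n)
      ≈⟨ +-cong (sumTo-cong≤ n column-suc) last-column ⟩
    sumTo n (column (suc n)) + column (suc n) (suc n)  ∎
    where
    column : ℕ → ℕ → Carrier
    column m k = sumTo (m ∸ k) (λ l → g (k N.+ l) k)
    column-suc : ∀ k → k N.≤ n → column n k + g (suc n) k ≈ column (suc n) k
    column-suc k k≤n rewrite NP.+-∸-assoc 1 k≤n | NP.+-suc k (n ∸ k) | NP.m+[n∸m]≡n k≤n = refl
    last-column : g (suc n) (suc n) ≈ column (suc n) (suc n)
    last-column rewrite NP.n∸n≡0 n | NP.+-identityʳ n = refl

  module _ {g : ℕ → Carrier} (g-odd : ∀ j → g (suc (2 N.* j)) ≈ 0#) where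
    sumTo-even : ∀ h → sumTo (2 N.* h) g ≈ sumTo h (λ j → g (2 N.* j))
    sumTo-odd : ∀ h → sumTo (suc (2 N.* h)) g ≈ sumTo h (λ j → g (2 N.* j))
    sumTo-even zero = refl
    sumTo-even (suc h) = begin
      sumTo (2 N.* suc h) g                        ≡⟨ ≡.cong (λ m → sumTo m g) (NP.*-suc 2 h) ⟩
      sumTo (suc (2 N.* h)) g + g (2 N.+ 2 N.* h)   ≈⟨ +-congʳ (sumTo-odd h) ⟩
      sumTo h evens + g (2 N.+ 2 N.* h)            ≡⟨ ≡.cong (λ m → sumTo h evens + g m) (NP.*-suc 2 h) ⟨
      sumTo (suc h) evens                          ∎
      where
      evens : ℕ → Carrier
      evens j = g (2 N.* j)
    sumTo-odd h = trans (+-cong (sumTo-even h) (g-odd h)) (+-identityʳ _)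

    sumTo-evens : ∀ n → sumTo n g ≈ sumTo ⌊ n /2⌋ (λ j → g (2 N.* j))
    sumTo-evens n with ⌊n/2⌋-parity n
    ... | inj₁ n≡2h = trans (reflexive (≡.cong (λ m → sumTo m g) n≡2h)) (sumTo-even ⌊ n /2⌋)
    ... | inj₂ n≡2h+1 = trans (reflexive (≡.cong (λ m → sumTo m g) n≡2h+1)) (sumTo-odd ⌊ n /2⌋)

  -- Splits each weight m + 1 as l + (m + 1 - l); the boundary terms l = 0 and l = m + 1 drop out.
  ι-suc-*-sumTo : ∀ m (f : ℕ → Carrier) → ι (suc m) * sumTo (suc m) f ≈
    sumTo m (λ l → ι (suc l) * f (suc l)) + sumTo m (λ l → ι (suc (m ∸ l)) * f l)
  ι-suc-*-sumTo m f = begin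
    ι (suc m) * sumTo (suc m) f
      ≈⟨ sumTo-*ˡ (suc m) _ f ⟨
    sumTo (suc m) (λ l → ι (suc m) * f l)
      ≈⟨ sumTo-cong≤ (suc m) (λ l l≤ → trans (*-congʳ (split l l≤)) (distribʳ _ _ _)) ⟩
    sumTo (suc m) (λ l → ι l * f l + ι (suc m ∸ l) * f l)
      ≈⟨ sumTo-+ (suc m) _ _ ⟩
    sumTo (suc m) (λ l → ι l * f l) + (sumTo m (λ l → ι (suc m ∸ l) * f l) + ι (m ∸ m) * f (suc m))
      ≈⟨ +-cong (sumTo-sucˡ m _) (+-cong (sumTo-cong≤ m (λ l l≤m → *-congʳ (reflexive (≡.cong ι (NP.+-∸-assoc 1 l≤m))))) last) ⟩
    (0# * f 0 + sumTo m (λ l → ι (suc l) * f (suc l))) + (sumTo m (λ l → ι (suc (m ∸ l)) * f l) + 0#)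
      ≈⟨ +-cong (trans (+-congʳ (zeroˡ _)) (+-identityˡ _)) (+-identityʳ _) ⟩
    sumTo m (λ l → ι (suc l) * f (suc l)) + sumTo m (λ l → ι (suc (m ∸ l)) * f l) ∎
    where
    split : ∀ l → l N.≤ suc m → ι (suc m) ≈ ι l + ι (suc m ∸ l)
    split l l≤ = trans (reflexive (≡.cong ι (≡.sym (NP.m+[n∸m]≡n l≤)))) (ι-+ l (suc m ∸ l))
    last : ι (m ∸ m) * f (suc m) ≈ 0#
    last rewrite NP.n∸n≡0 m = zeroˡ _

  ι-suc-*-cancelˡ : ∀ m {x y} → ι (suc m) * x ≈ ι (suc m) * y → x ≈ y
  ι-suc-*-cancelˡ m {x} {y} e = trans (sym (undo x)) (trans (*-congˡ e) (undo y))
    where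
    undo : ∀ z → invPos m * (ι (suc m) * z) ≈ z
    undo z = trans (sym (*-assoc _ _ _)) (trans (*-congʳ (trans (*-comm _ _) (invPos-inverse m))) (*-identityˡ z))

  pow-cong : ∀ k {x y} → x ≈ y → pow x k ≈ pow y k
  pow-cong zero x≈y = refl
  pow-cong (suc k) x≈y = *-cong (pow-cong k x≈y) x≈y

  pow-+ : ∀ x k l → pow x (k N.+ l) ≈ pow x k * pow x l
  pow-+ x zero l = sym (*-identityˡ _)
  pow-+ x (suc k) l = begin
    pow x (k N.+ l) * x       ≈⟨ *-congʳ (pow-+ x k l) ⟩
    pow x k * pow x l * x     ≈⟨ solve 3 (λ a b c → a :* b :* c := a :* c :* b) refl _ _ _ ⟩
    pow x k * x * pow x l     ∎

  pow-* : ∀ x y k → pow (x * y) k ≈ pow x k * pow y k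
  pow-* x y zero = sym (*-identityˡ _)
  pow-* x y (suc k) = trans (*-congʳ (pow-* x y k))
    (solve 4 (λ a b c d → a :* b :* (c :* d) := a :* c :* (b :* d)) refl _ _ _ _)

  falling-cong : ∀ k {x y} → x ≈ y → falling x k ≈ falling y k
  falling-cong zero x≈y = refl
  falling-cong (suc k) x≈y = *-cong (falling-cong k x≈y) (+-congʳ x≈y)

  binom-cong : ∀ k {x y} → x ≈ y → binom x k ≈ binom y k
  binom-cong k x≈y = *-congʳ (falling-cong k x≈y)

  binom-0 : ∀ x → binom x 0 ≈ 1#
  binom-0 x = *-identityʳ 1#

  falling-suc : ∀ x k → falling x (suc k) ≈ x * falling (x - 1#) k
  falling-suc x zero = solve 1 (λ x → :1 :* (x :- :0) := x :* :1) refl x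
  falling-suc x (suc k) = begin
    falling x (suc k) * (x - (1# + ι k))     ≈⟨ *-congʳ (falling-suc x k) ⟩
    x * F * (x - (1# + ι k))                 ≈⟨ solve 3 (λ x F i → x :* F :* (x :- (:1 :+ i)) := x :* (F :* (x :- :1 :- i))) refl x F (ι k) ⟩
    x * (F * (x - 1# - ι k))                 ∎
    where F = falling (x - 1#) k

  falling-+ : ∀ x k l → falling x (k N.+ l) ≈ falling x k * falling (x - ι k) l
  falling-+ x zero l = trans (falling-cong l (solve 1 (λ x → x := x :- :0) refl x)) (sym (*-identityˡ _))
  falling-+ x (suc k) l = begin
    falling x (suc (k N.+ l))                                      ≈⟨ falling-suc x (k N.+ l) ⟩
    x * falling (x - 1#) (k N.+ l)                                 ≈⟨ *-congˡ (falling-+ (x - 1#) k l) ⟩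
    x * (falling (x - 1#) k * falling (x - 1# - ι k) l)            ≈⟨ *-assoc _ _ _ ⟨
    x * falling (x - 1#) k * falling (x - 1# - ι k) l              ≈⟨ *-cong (falling-suc x k) (falling-cong l shift) ⟨
    falling x (suc k) * falling (x - ι (suc k)) l                  ∎
    where
    shift : x - ι (suc k) ≈ x - 1# - ι k
    shift = solve 2 (λ x i → x :- (:1 :+ i) := x :- :1 :- i) refl x (ι k)

  binom-absorb : ∀ x k → ι (suc k) * binom x (suc k) ≈ x * binom (x - 1#) k
  binom-absorb x k = begin
    ι (suc k) * (falling x (suc k) * (invFact k * invPos k))
      ≈⟨ solve 4 (λ a b c d → a :* (b :* (c :* d)) := b :* c :* (a :* d)) refl _ _ _ _ ⟩
    falling x (suc k) * invFact k * (ι (suc k) * invPos k)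
      ≈⟨ *-cong (*-congʳ (falling-suc x k)) (invPos-inverse k) ⟩
    x * falling (x - 1#) k * invFact k * 1#
      ≈⟨ solve 3 (λ a b c → a :* b :* c :* :1 := a :* (b :* c)) refl _ _ _ ⟩
    x * binom (x - 1#) k ∎

  binom-absorb-sub : ∀ x k → binom x k * (x - ι k) ≈ x * binom (x - 1#) k
  binom-absorb-sub x k = begin
    falling x k * invFact k * (x - ι k)   ≈⟨ solve 3 (λ a b c → a :* b :* c := a :* c :* b) refl _ _ _ ⟩
    falling x (suc k) * invFact k         ≈⟨ *-congʳ (falling-suc x k) ⟩
    x * falling (x - 1#) k * invFact k    ≈⟨ *-assoc _ _ _ ⟩
    x * binom (x - 1#) k                  ∎

  binom-pascal : ∀ x k → binom (x + 1#) (suc k) ≈ binom x (suc k) + binom x k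
  binom-pascal x k = ι-suc-*-cancelˡ k (begin
    ι (suc k) * binom (x + 1#) (suc k)
      ≈⟨ binom-absorb (x + 1#) k ⟩
    (x + 1#) * binom (x + 1# - 1#) k
      ≈⟨ *-congˡ (binom-cong k (solve 1 (λ x → x :+ :1 :- :1 := x) refl x)) ⟩
    (x + 1#) * binom x k
      ≈⟨ solve 3 (λ x B i → (x :+ :1) :* B := B :* (x :- i) :+ (:1 :+ i) :* B) refl x (binom x k) (ι k) ⟩
    binom x k * (x - ι k) + ι (suc k) * binom x k
      ≈⟨ +-congʳ (trans (binom-absorb-sub x k) (sym (binom-absorb x k))) ⟩
    ι (suc k) * binom x (suc k) + ι (suc k) * binom x k
      ≈⟨ distribˡ _ _ _ ⟨
    ι (suc k) * (binom x (suc k) + binom x k) ∎)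

  binom-ι-self : ∀ n → binom (ι n) n ≈ 1#
  binom-ι-self zero = *-identityʳ 1#
  binom-ι-self (suc n) = begin
    falling (ι (suc n)) (suc n) * (invFact n * invPos n)
      ≈⟨ *-congʳ (falling-suc (ι (suc n)) n) ⟩
    ι (suc n) * falling (ι (suc n) - 1#) n * (invFact n * invPos n)
      ≈⟨ *-congʳ (*-congˡ (falling-cong n (solve 1 (λ i → :1 :+ i :- :1 := i) refl (ι n)))) ⟩
    ι (suc n) * falling (ι n) n * (invFact n * invPos n)
      ≈⟨ solve 4 (λ a b c d → a :* b :* (c :* d) := (a :* d) :* (b :* c)) refl _ _ _ _ ⟩
    (ι (suc n) * invPos n) * binom (ι n) n
      ≈⟨ *-cong (invPos-inverse n) (binom-ι-self n) ⟩
    1# * 1#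
      ≈⟨ *-identityʳ 1# ⟩
    1# ∎

  binom-*-binom-sub : ∀ a k l → binom a k * binom (a - ι k) l ≈ falling a (k N.+ l) * (invFact k * invFact l)
  binom-*-binom-sub a k l = begin
    falling a k * invFact k * (falling (a - ι k) l * invFact l)
      ≈⟨ solve 4 (λ a b c d → a :* b :* (c :* d) := a :* c :* (b :* d)) refl _ _ _ _ ⟩
    falling a k * falling (a - ι k) l * (invFact k * invFact l)
      ≈⟨ *-congʳ (falling-+ a k l) ⟨
    falling a (k N.+ l) * (invFact k * invFact l) ∎

  binom-+-*-binom : ∀ a k l → binom a (k N.+ l) * binom (ι (k N.+ l)) k ≈ falling a (k N.+ l) * (invFact k * invFact l)
  binom-+-*-binom a k l = begin
    falling a (k N.+ l) * invFact (k N.+ l) * (falling (ι (k N.+ l)) k * invFact k)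
      ≈⟨ solve 4 (λ a b c d → a :* b :* (c :* d) := a :* (d :* (c :* b))) refl _ _ _ _ ⟩
    falling a (k N.+ l) * (invFact k * (falling (ι (k N.+ l)) k * invFact (k N.+ l)))
      ≈⟨ *-congˡ (*-congˡ falling-ι-+) ⟩
    falling a (k N.+ l) * (invFact k * invFact l) ∎
    where
    falling-ι-+ : falling (ι (k N.+ l)) k * invFact (k N.+ l) ≈ invFact l
    falling-ι-+ = begin
      falling (ι (k N.+ l)) k * invFact (k N.+ l)
        ≈⟨ *-identityʳ _ ⟨
      falling (ι (k N.+ l)) k * invFact (k N.+ l) * 1#
        ≈⟨ *-congˡ (binom-ι-self l) ⟨
      falling (ι (k N.+ l)) k * invFact (k N.+ l) * (falling (ι l) l * invFact l)
        ≈⟨ *-congˡ (*-congʳ (falling-cong l ι-l)) ⟩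
      falling (ι (k N.+ l)) k * invFact (k N.+ l) * (falling (ι (k N.+ l) - ι k) l * invFact l)
        ≈⟨ solve 4 (λ a b c d → a :* b :* (c :* d) := a :* c :* b :* d) refl _ _ _ _ ⟩
      falling (ι (k N.+ l)) k * falling (ι (k N.+ l) - ι k) l * invFact (k N.+ l) * invFact l
        ≈⟨ *-congʳ (*-congʳ (falling-+ _ k l)) ⟨
      binom (ι (k N.+ l)) (k N.+ l) * invFact l
        ≈⟨ *-congʳ (binom-ι-self (k N.+ l)) ⟩
      1# * invFact l
        ≈⟨ *-identityˡ _ ⟩
      invFact l ∎
      where
      ι-l : ι l ≈ ι (k N.+ l) - ι k
      ι-l = trans (solve 2 (λ a b → b := a :+ b :- a) refl (ι k) (ι l)) (+-congʳ (sym (ι-+ k l)))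

  binom-revision : ∀ a k l → binom a (k N.+ l) * binom (ι (k N.+ l)) k ≈ binom a k * binom (a - ι k) l
  binom-revision a k l = trans (binom-+-*-binom a k l) (sym (binom-*-binom-sub a k l))

  binom-vandermonde : ∀ m x y → sumTo m (λ l → binom x l * binom y (m ∸ l)) ≈ binom (x + y) m
  binom-vandermonde zero x y = trans (*-cong (binom-0 x) (binom-0 y)) (trans (*-identityʳ 1#) (sym (binom-0 (x + y))))
  binom-vandermonde (suc m) x y = ι-suc-*-cancelˡ m (begin
    ι (suc m) * sumTo (suc m) (λ l → binom x l * binom y (suc m ∸ l))
      ≈⟨ ι-suc-*-sumTo m _ ⟩
    sumTo m (λ l → ι (suc l) * (binom x (suc l) * binom y (m ∸ l))) + sumTo m (λ l → ι (suc (m ∸ l)) * (binom x l * binom y (suc m ∸ l)))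
      ≈⟨ +-cong (sumTo-cong m absorb-x) (sumTo-cong≤ m absorb-y) ⟩
    sumTo m (λ l → x * (binom (x - 1#) l * binom y (m ∸ l))) + sumTo m (λ l → y * (binom x l * binom (y - 1#) (m ∸ l)))
      ≈⟨ +-cong (sumTo-*ˡ m x _) (sumTo-*ˡ m y _) ⟩
    x * sumTo m (λ l → binom (x - 1#) l * binom y (m ∸ l)) + y * sumTo m (λ l → binom x l * binom (y - 1#) (m ∸ l))
      ≈⟨ +-cong (*-congˡ (binom-vandermonde m (x - 1#) y)) (*-congˡ (binom-vandermonde m x (y - 1#))) ⟩
    x * binom (x - 1# + y) m + y * binom (x + (y - 1#)) m
      ≈⟨ +-cong (*-congˡ (binom-cong m (solve 2 (λ x y → x :- :1 :+ y := x :+ y :- :1) refl x y)))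
                (*-congˡ (binom-cong m (solve 2 (λ x y → x :+ (y :- :1) := x :+ y :- :1) refl x y))) ⟩
    x * binom (x + y - 1#) m + y * binom (x + y - 1#) m
      ≈⟨ distribʳ _ _ _ ⟨
    (x + y) * binom (x + y - 1#) m
      ≈⟨ binom-absorb (x + y) m ⟨
    ι (suc m) * binom (x + y) (suc m) ∎)
    where
    absorb-x : ∀ l → ι (suc l) * (binom x (suc l) * binom y (m ∸ l)) ≈ x * (binom (x - 1#) l * binom y (m ∸ l))
    absorb-x l = trans (sym (*-assoc _ _ _)) (trans (*-congʳ (binom-absorb x l)) (*-assoc _ _ _))
    absorb-y : ∀ l → l N.≤ m → ι (suc (m ∸ l)) * (binom x l * binom y (suc m ∸ l)) ≈ y * (binom x l * binom (y - 1#) (m ∸ l))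
    absorb-y l l≤m = begin
      ι (suc (m ∸ l)) * (binom x l * binom y (suc m ∸ l))
        ≡⟨ ≡.cong (λ j → ι (suc (m ∸ l)) * (binom x l * binom y j)) (NP.+-∸-assoc 1 l≤m) ⟩
      ι (suc (m ∸ l)) * (binom x l * binom y (suc (m ∸ l)))
        ≈⟨ solve 3 (λ a b c → a :* (b :* c) := b :* (a :* c)) refl _ _ _ ⟩
      binom x l * (ι (suc (m ∸ l)) * binom y (suc (m ∸ l)))
        ≈⟨ *-congˡ (binom-absorb y (m ∸ l)) ⟩
      binom x l * (y * binom (y - 1#) (m ∸ l))
        ≈⟨ solve 3 (λ a b c → a :* (b :* c) := b :* (a :* c)) refl _ _ _ ⟩
      y * (binom x l * binom (y - 1#) (m ∸ l)) ∎

  -- The coefficient of t^m in ((1 + t)^2 + s t)^x = Σ_l C(x,l) (s t)^l (1 + t)^(2x - 2l).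
  trinomial : Carrier → Carrier → ℕ → Carrier
  trinomial s x m = sumTo m (λ l → binom x l * binom (ι 2 * x - ι 2 * ι l) (m ∸ l) * pow s l)

  binomPred : Carrier → ℕ → Carrier
  binomPred z zero = 0#
  binomPred z (suc j) = binom z j

  trinomialPred : Carrier → Carrier → ℕ → Carrier
  trinomialPred s x zero = 0#
  trinomialPred s x (suc m) = trinomial s x m

  binom-pascal′ : ∀ z j → binom (z + 1#) j ≈ binom z j + binomPred z j
  binom-pascal′ z zero = trans (binom-0 (z + 1#)) (sym (trans (+-identityʳ _) (binom-0 z)))
  binom-pascal′ z (suc j) = binom-pascal z j

  trinomial-0 : ∀ s x → trinomial s x 0 ≈ 1#
  trinomial-0 s x = trans (*-identityʳ _) (trans (*-cong (binom-0 x) (binom-0 (ι 2 * x - ι 2 * ι 0))) (*-identityʳ 1#))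

  sumTo-binomPred : ∀ s x m →
    sumTo m (λ l → binom x l * binomPred (ι 2 * x - ι 2 * ι l) (m ∸ l) * pow s l) ≈ trinomialPred s x m
  sumTo-binomPred s x zero = trans (*-congʳ (zeroʳ _)) (zeroˡ _)
  sumTo-binomPred s x (suc m) = trans (+-cong (sumTo-cong≤ m shift) last) (+-identityʳ _)
    where
    shift : ∀ l → l N.≤ m → binom x l * binomPred (ι 2 * x - ι 2 * ι l) (suc m ∸ l) * pow s l
                          ≈ binom x l * binom (ι 2 * x - ι 2 * ι l) (m ∸ l) * pow s l
    shift l l≤m rewrite NP.+-∸-assoc 1 l≤m = refl
    last : binom x (suc m) * binomPred (ι 2 * x - ι 2 * ι (suc m)) (m ∸ m) * pow s (suc m) ≈ 0#
    last rewrite NP.n∸n≡0 m = trans (*-congʳ (zeroʳ _)) (zeroˡ _)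

  trinomial-suc : ∀ s x m → ι (suc m) * trinomial s x (suc m)
                  ≈ (s + ι 2) * x * trinomial s (x - 1#) m + ι 2 * x * trinomialPred s (x - 1#) m
  trinomial-suc s x m = begin
    ι (suc m) * trinomial s x (suc m)
      ≈⟨ ι-suc-*-sumTo m _ ⟩
    sumTo m (λ l → ι (suc l) * (binom x (suc l) * binom (ι 2 * x - ι 2 * ι (suc l)) (m ∸ l) * pow s (suc l)))
      + sumTo m (λ l → ι (suc (m ∸ l)) * (binom x l * binom (ι 2 * x - ι 2 * ι l) (suc m ∸ l) * pow s l))
      ≈⟨ +-cong (sumTo-cong m absorb-l) (sumTo-cong≤ m absorb-m∸l) ⟩
    sumTo m (λ l → x * s * term l) + sumTo m (λ l → ι 2 * x * (term l + termPred l))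
      ≈⟨ +-cong (sumTo-*ˡ m _ _) (trans (sumTo-*ˡ m _ _) (*-congˡ (sumTo-+ m _ _))) ⟩
    x * s * trinomial s (x - 1#) m + ι 2 * x * (trinomial s (x - 1#) m + sumTo m termPred)
      ≈⟨ +-congˡ (*-congˡ (+-congˡ (sumTo-binomPred s (x - 1#) m))) ⟩
    x * s * trinomial s (x - 1#) m + ι 2 * x * (trinomial s (x - 1#) m + trinomialPred s (x - 1#) m)
      ≈⟨ solve 4 (λ s x T P → x :* s :* T :+ :2 :* x :* (T :+ P) := (s :+ :2) :* x :* T :+ :2 :* x :* P) refl _ _ _ _ ⟩
    (s + ι 2) * x * trinomial s (x - 1#) m + ι 2 * x * trinomialPred s (x - 1#) m ∎
    where
    term termPred : ℕ → Carrier
    term l = binom (x - 1#) l * binom (ι 2 * (x - 1#) - ι 2 * ι l) (m ∸ l) * pow s l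
    termPred l = binom (x - 1#) l * binomPred (ι 2 * (x - 1#) - ι 2 * ι l) (m ∸ l) * pow s l

    absorb-l : ∀ l → ι (suc l) * (binom x (suc l) * binom (ι 2 * x - ι 2 * ι (suc l)) (m ∸ l) * pow s (suc l)) ≈ x * s * term l
    absorb-l l = begin
      ι (suc l) * (binom x (suc l) * binom (ι 2 * x - ι 2 * ι (suc l)) (m ∸ l) * (pow s l * s))
        ≈⟨ solve 5 (λ a b c d e → a :* (b :* c :* (d :* e)) := a :* b :* c :* d :* e) refl _ _ _ _ _ ⟩
      ι (suc l) * binom x (suc l) * binom (ι 2 * x - ι 2 * ι (suc l)) (m ∸ l) * pow s l * s
        ≈⟨ *-congʳ (*-congʳ (*-cong (binom-absorb x l) (binom-cong (m ∸ l)
              (solve 2 (λ x i → :2 :* x :- :2 :* (:1 :+ i) := :2 :* (x :- :1) :- :2 :* i) refl x (ι l))))) ⟩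
      x * binom (x - 1#) l * binom (ι 2 * (x - 1#) - ι 2 * ι l) (m ∸ l) * pow s l * s
        ≈⟨ solve 5 (λ a b c d e → a :* b :* c :* d :* e := a :* e :* (b :* c :* d)) refl _ _ _ _ _ ⟩
      x * s * term l ∎

    absorb-m∸l : ∀ l → l N.≤ m → ι (suc (m ∸ l)) * (binom x l * binom (ι 2 * x - ι 2 * ι l) (suc m ∸ l) * pow s l)
                                ≈ ι 2 * x * (term l + termPred l)
    absorb-m∸l l l≤m = begin
      ι (suc j) * (B * binom Z (suc m ∸ l) * p)
        ≡⟨ ≡.cong (λ i → ι (suc j) * (B * binom Z i * p)) (NP.+-∸-assoc 1 l≤m) ⟩
      ι (suc j) * (B * binom Z (suc j) * p)
        ≈⟨ solve 4 (λ a b c d → a :* (b :* c :* d) := b :* (a :* c) :* d) refl _ _ _ _ ⟩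
      B * (ι (suc j) * binom Z (suc j)) * p
        ≈⟨ *-congʳ (*-congˡ (binom-absorb Z j)) ⟩
      B * (Z * binom (Z - 1#) j) * p
        ≈⟨ *-congʳ (*-congˡ (*-congˡ (trans (binom-cong j Z-1≈W+1) (binom-pascal′ W j)))) ⟩
      B * (Z * (binom W j + binomPred W j)) * p
        ≈⟨ solve 6 (λ b x i u v p → b :* ((:2 :* x :- :2 :* i) :* (u :+ v)) :* p
                                  := :2 :* (b :* (x :- i)) :* (u :+ v) :* p) refl B x (ι l) _ _ p ⟩
      ι 2 * (B * (x - ι l)) * (binom W j + binomPred W j) * p
        ≈⟨ *-congʳ (*-congʳ (*-congˡ (binom-absorb-sub x l))) ⟩
      ι 2 * (x * B′) * (binom W j + binomPred W j) * p
        ≈⟨ solve 5 (λ x b u v p → :2 :* (x :* b) :* (u :+ v) :* p := :2 :* x :* (b :* u :* p :+ b :* v :* p)) refl x B′ _ _ p ⟩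
      ι 2 * x * (term l + termPred l) ∎
      where
      j = m ∸ l
      p = pow s l
      B = binom x l
      B′ = binom (x - 1#) l
      Z = ι 2 * x - ι 2 * ι l
      W = ι 2 * (x - 1#) - ι 2 * ι l
      Z-1≈W+1 : Z - 1# ≈ W + 1#
      Z-1≈W+1 = solve 2 (λ x i → :2 :* x :- :2 :* i :- :1 := :2 :* (x :- :1) :- :2 :* i :+ :1) refl x (ι l)

  trinomial-neg4 : ∀ m x → trinomial (- ι 4) x m ≈ pow (- 1#) m * binom (ι 2 * x) m
  trinomialPred-neg4 : ∀ m x → trinomialPred (- ι 4) x m ≈ - pow (- 1#) m * binomPred (ι 2 * x) m

  trinomial-neg4 zero x = trans (trinomial-0 (- ι 4) x) (sym (trans (*-identityˡ _) (binom-0 (ι 2 * x))))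
  trinomial-neg4 (suc m) x = ι-suc-*-cancelˡ m (begin
    ι (suc m) * trinomial (- ι 4) x (suc m)
      ≈⟨ trinomial-suc (- ι 4) x m ⟩
    (- ι 4 + ι 2) * x * trinomial (- ι 4) (x - 1#) m + ι 2 * x * trinomialPred (- ι 4) (x - 1#) m
      ≈⟨ +-cong (*-congˡ (trinomial-neg4 m (x - 1#))) (*-congˡ (trinomialPred-neg4 m (x - 1#))) ⟩
    (- ι 4 + ι 2) * x * (p * binom y m) + ι 2 * x * (- p * binomPred y m)
      ≈⟨ solve 4 (λ x p b b′ → (:- :4 :+ :2) :* x :* (p :* b) :+ :2 :* x :* (:- p :* b′)
                               := p :* :- :1 :* (:2 :* x :* (b :+ b′))) refl x p _ _ ⟩
    p * - 1# * (ι 2 * x * (binom y m + binomPred y m))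
      ≈⟨ *-congˡ (*-congˡ (binom-pascal′ y m)) ⟨
    p * - 1# * (ι 2 * x * binom (y + 1#) m)
      ≈⟨ *-congˡ (*-congˡ (binom-cong m (solve 1 (λ x → :2 :* (x :- :1) :+ :1 := :2 :* x :- :1) refl x))) ⟩
    p * - 1# * (ι 2 * x * binom (ι 2 * x - 1#) m)
      ≈⟨ *-congˡ (binom-absorb (ι 2 * x) m) ⟨
    p * - 1# * (ι (suc m) * binom (ι 2 * x) (suc m))
      ≈⟨ solve 4 (λ p q n b → p :* q :* (n :* b) := n :* (p :* q :* b)) refl _ _ _ _ ⟩
    ι (suc m) * (p * - 1# * binom (ι 2 * x) (suc m)) ∎)
    where
    p = pow (- 1#) m
    y = ι 2 * (x - 1#)

  trinomialPred-neg4 zero x = sym (zeroʳ _)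
  trinomialPred-neg4 (suc m) x =
    trans (trinomial-neg4 m x) (solve 2 (λ p b → p :* b := :- (p :* :- :1) :* b) refl _ _)

  trinomial-neg2-suc : ∀ m x → ι (suc m) * trinomial (- ι 2) x (suc m) ≈ ι 2 * x * trinomialPred (- ι 2) (x - 1#) m
  trinomial-neg2-suc m x = trans (trinomial-suc (- ι 2) x m)
    (solve 3 (λ x T P → (:- :2 :+ :2) :* x :* T :+ :2 :* x :* P := :2 :* x :* P) refl x _ _)

  trinomial-neg2-even : ∀ j x → trinomial (- ι 2) x (2 N.* j) ≈ binom x j
  trinomial-neg2-odd : ∀ j x → trinomial (- ι 2) x (suc (2 N.* j)) ≈ 0#
  trinomialPred-neg2-even : ∀ j x → trinomialPred (- ι 2) x (2 N.* j) ≈ 0#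

  trinomial-neg2-even zero x = trans (trinomial-0 (- ι 2) x) (sym (binom-0 x))
  trinomial-neg2-even (suc j) x = begin
    trinomial (- ι 2) x (2 N.* suc j)      ≡⟨ ≡.cong (trinomial (- ι 2) x) (NP.*-suc 2 j) ⟩
    trinomial (- ι 2) x (suc (suc 2j))     ≈⟨ ι-suc-*-cancelˡ (suc 2j) step ⟩
    binom x (suc j)                        ∎
    where
    2j = 2 N.* j
    step : ι (suc (suc 2j)) * trinomial (- ι 2) x (suc (suc 2j)) ≈ ι (suc (suc 2j)) * binom x (suc j)
    step = begin
      ι (suc (suc 2j)) * trinomial (- ι 2) x (suc (suc 2j))   ≈⟨ trinomial-neg2-suc (suc 2j) x ⟩
      ι 2 * x * trinomial (- ι 2) (x - 1#) 2j                ≈⟨ *-congˡ (trinomial-neg2-even j (x - 1#)) ⟩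
      ι 2 * x * binom (x - 1#) j                             ≈⟨ *-assoc _ _ _ ⟩
      ι 2 * (x * binom (x - 1#) j)                           ≈⟨ *-congˡ (binom-absorb x j) ⟨
      ι 2 * (ι (suc j) * binom x (suc j))                    ≈⟨ *-assoc _ _ _ ⟨
      ι 2 * ι (suc j) * binom x (suc j)                      ≈⟨ *-congʳ (ι-* 2 (suc j)) ⟨
      ι (2 N.* suc j) * binom x (suc j)                      ≡⟨ ≡.cong (λ i → ι i * binom x (suc j)) (NP.*-suc 2 j) ⟩
      ι (suc (suc 2j)) * binom x (suc j)                     ∎

  trinomial-neg2-odd j x = ι-suc-*-cancelˡ (2 N.* j) (begin
    ι (suc (2 N.* j)) * trinomial (- ι 2) x (suc (2 N.* j))   ≈⟨ trinomial-neg2-suc (2 N.* j) x ⟩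
    ι 2 * x * trinomialPred (- ι 2) (x - 1#) (2 N.* j)       ≈⟨ *-congˡ (trinomialPred-neg2-even j (x - 1#)) ⟩
    ι 2 * x * 0#                                              ≈⟨ zeroʳ _ ⟩
    0#                                                        ≈⟨ zeroʳ _ ⟨
    ι (suc (2 N.* j)) * 0#                                    ∎)

  trinomialPred-neg2-even zero x = refl
  trinomialPred-neg2-even (suc j) x =
    trans (reflexive (≡.cong (trinomialPred (- ι 2) x) (NP.*-suc 2 j))) (trinomial-neg2-odd j x)

  IsBinomialTransform : (cs ds : ℕ → Carrier) → Set ℓ
  IsBinomialTransform cs ds = ∀ n → ds n ≈ sumTo n (λ i → binom (ι n) i * cs i)

  module _ {cs ds : ℕ → Carrier} (transform : IsBinomialTransform cs ds) where

    sumTo-binomialTransform : ∀ a n (w : ℕ → Carrier) →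
      sumTo n (λ i → binom a i * w i * ds i)
      ≈ sumTo n (λ k → binom a k * cs k * sumTo (n ∸ k) (λ l → binom (a - ι k) l * w (k N.+ l)))
    sumTo-binomialTransform a n w = begin
      sumTo n (λ i → binom a i * w i * ds i)
        ≈⟨ sumTo-cong n (λ i → *-congˡ (transform i)) ⟩
      sumTo n (λ i → binom a i * w i * sumTo i (λ k → binom (ι i) k * cs k))
        ≈⟨ sumTo-cong n (λ i → sumTo-*ˡ i _ _) ⟨
      sumTo n (λ i → sumTo i (λ k → binom a i * w i * (binom (ι i) k * cs k)))
        ≈⟨ sumTo-triangle n _ ⟩
      sumTo n (λ k → sumTo (n ∸ k) (λ l → binom a (k N.+ l) * w (k N.+ l) * (binom (ι (k N.+ l)) k * cs k)))
        ≈⟨ sumTo-cong n (λ k → sumTo-cong (n ∸ k) (revise k)) ⟩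
      sumTo n (λ k → sumTo (n ∸ k) (λ l → binom a k * cs k * (binom (a - ι k) l * w (k N.+ l))))
        ≈⟨ sumTo-cong n (λ k → sumTo-*ˡ (n ∸ k) _ _) ⟩
      sumTo n (λ k → binom a k * cs k * sumTo (n ∸ k) (λ l → binom (a - ι k) l * w (k N.+ l))) ∎
      where
      revise : ∀ k l → binom a (k N.+ l) * w (k N.+ l) * (binom (ι (k N.+ l)) k * cs k)
                       ≈ binom a k * cs k * (binom (a - ι k) l * w (k N.+ l))
      revise k l = begin
        binom a (k N.+ l) * w (k N.+ l) * (binom (ι (k N.+ l)) k * cs k)
          ≈⟨ solve 4 (λ A w C c → A :* w :* (C :* c) := A :* C :* w :* c) refl _ _ _ _ ⟩
        binom a (k N.+ l) * binom (ι (k N.+ l)) k * w (k N.+ l) * cs k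
          ≈⟨ *-congʳ (*-congʳ (binom-revision a k l)) ⟩
        binom a k * binom (a - ι k) l * w (k N.+ l) * cs k
          ≈⟨ solve 4 (λ A B w c → A :* B :* w :* c := A :* c :* (B :* w)) refl _ _ _ _ ⟩
        binom a k * cs k * (binom (a - ι k) l * w (k N.+ l)) ∎

    binomialTransform-vandermonde : ∀ a b n →
      sumTo n (λ i → binom a i * binom b (n ∸ i) * ds i)
      ≈ sumTo n (λ j → binom a j * binom (a + b - ι j) (n ∸ j) * cs j)
    binomialTransform-vandermonde a b n = begin
      sumTo n (λ i → binom a i * binom b (n ∸ i) * ds i)
        ≈⟨ sumTo-binomialTransform a n (λ i → binom b (n ∸ i)) ⟩
      sumTo n (λ k → binom a k * cs k * sumTo (n ∸ k) (λ l → binom (a - ι k) l * binom b (n ∸ (k N.+ l))))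
        ≈⟨ sumTo-cong n (λ k → *-congˡ (inner k)) ⟩
      sumTo n (λ k → binom a k * cs k * binom (a + b - ι k) (n ∸ k))
        ≈⟨ sumTo-cong n (λ k → solve 3 (λ A c B → A :* c :* B := A :* B :* c) refl _ _ _) ⟩
      sumTo n (λ j → binom a j * binom (a + b - ι j) (n ∸ j) * cs j) ∎
      where
      inner : ∀ k → sumTo (n ∸ k) (λ l → binom (a - ι k) l * binom b (n ∸ (k N.+ l))) ≈ binom (a + b - ι k) (n ∸ k)
      inner k = begin
        sumTo (n ∸ k) (λ l → binom (a - ι k) l * binom b (n ∸ (k N.+ l)))
          ≈⟨ sumTo-cong (n ∸ k) (λ l → reflexive (≡.cong (λ i → binom (a - ι k) l * binom b i) (≡.sym (NP.∸-+-assoc n k l)))) ⟩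
        sumTo (n ∸ k) (λ l → binom (a - ι k) l * binom b (n ∸ k ∸ l))
          ≈⟨ binom-vandermonde (n ∸ k) (a - ι k) b ⟩
        binom (a - ι k + b) (n ∸ k)
          ≈⟨ binom-cong (n ∸ k) (solve 3 (λ a b i → a :- i :+ b := a :+ b :- i) refl a b (ι k)) ⟩
        binom (a + b - ι k) (n ∸ k) ∎

    sumTo-trinomialTransform : ∀ s a n →
      sumTo n (λ i → binom a i * binom (ι 2 * a - ι 2 * ι i) (n ∸ i) * pow s i * ds i)
      ≈ sumTo n (λ k → binom a k * cs k * (pow s k * trinomial s (a - ι k) (n ∸ k)))
    sumTo-trinomialTransform s a n = begin
      sumTo n (λ i → binom a i * binom (ι 2 * a - ι 2 * ι i) (n ∸ i) * pow s i * ds i)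
        ≈⟨ sumTo-cong n (λ i → *-congʳ (*-assoc _ _ _)) ⟩
      sumTo n (λ i → binom a i * w i * ds i)
        ≈⟨ sumTo-binomialTransform a n w ⟩
      sumTo n (λ k → binom a k * cs k * sumTo (n ∸ k) (λ l → binom (a - ι k) l * w (k N.+ l)))
        ≈⟨ sumTo-cong n (λ k → *-congˡ (trans (sumTo-cong (n ∸ k) (shift k)) (sumTo-*ˡ (n ∸ k) _ _))) ⟩
      sumTo n (λ k → binom a k * cs k * (pow s k * trinomial s (a - ι k) (n ∸ k))) ∎
      where
      w : ℕ → Carrier
      w i = binom (ι 2 * a - ι 2 * ι i) (n ∸ i) * pow s i
      shift : ∀ k l → binom (a - ι k) l * w (k N.+ l)
                      ≈ pow s k * (binom (a - ι k) l * binom (ι 2 * (a - ι k) - ι 2 * ι l) (n ∸ k ∸ l) * pow s l)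
      shift k l = begin
        binom (a - ι k) l * (binom (ι 2 * a - ι 2 * ι (k N.+ l)) (n ∸ (k N.+ l)) * pow s (k N.+ l))
          ≡⟨ ≡.cong (λ i → binom (a - ι k) l * (binom (ι 2 * a - ι 2 * ι (k N.+ l)) i * pow s (k N.+ l))) (NP.∸-+-assoc n k l) ⟨
        binom (a - ι k) l * (binom (ι 2 * a - ι 2 * ι (k N.+ l)) (n ∸ k ∸ l) * pow s (k N.+ l))
          ≈⟨ *-congˡ (*-cong (binom-cong (n ∸ k ∸ l) 2a-2[k+l]) (pow-+ s k l)) ⟩
        binom (a - ι k) l * (binom (ι 2 * (a - ι k) - ι 2 * ι l) (n ∸ k ∸ l) * (pow s k * pow s l))
          ≈⟨ solve 4 (λ B C p q → B :* (C :* (p :* q)) := p :* (B :* C :* q)) refl _ _ _ _ ⟩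
        pow s k * (binom (a - ι k) l * binom (ι 2 * (a - ι k) - ι 2 * ι l) (n ∸ k ∸ l) * pow s l) ∎
        where
        2a-2[k+l] : ι 2 * a - ι 2 * ι (k N.+ l) ≈ ι 2 * (a - ι k) - ι 2 * ι l
        2a-2[k+l] = trans (+-congˡ (-‿cong (*-congˡ (ι-+ k l))))
          (solve 3 (λ a i j → :2 :* a :- :2 :* (i :+ j) := :2 :* (a :- i) :- :2 :* j) refl a (ι k) (ι l))

    binomialTransform-trinomial-neg4 : ∀ a n →
      sumTo n (λ i → binom a i * binom (ι 2 * a - ι 2 * ι i) (n ∸ i) * pow (- ι 4) i * ds i)
      ≈ pow (- 1#) n * sumTo n (λ j → binom a j * binom (ι 2 * a - ι 2 * ι j) (n ∸ j) * pow (ι 4) j * cs j)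
    binomialTransform-trinomial-neg4 a n = begin
      sumTo n (λ i → binom a i * binom (ι 2 * a - ι 2 * ι i) (n ∸ i) * pow (- ι 4) i * ds i)
        ≈⟨ sumTo-trinomialTransform (- ι 4) a n ⟩
      sumTo n (λ k → binom a k * cs k * (pow (- ι 4) k * trinomial (- ι 4) (a - ι k) (n ∸ k)))
        ≈⟨ sumTo-cong≤ n closed-form ⟩
      sumTo n (λ j → pow (- 1#) n * (binom a j * binom (ι 2 * a - ι 2 * ι j) (n ∸ j) * pow (ι 4) j * cs j))
        ≈⟨ sumTo-*ˡ n _ _ ⟩
      pow (- 1#) n * sumTo n (λ j → binom a j * binom (ι 2 * a - ι 2 * ι j) (n ∸ j) * pow (ι 4) j * cs j) ∎
      where
      closed-form : ∀ k → k N.≤ n →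
        binom a k * cs k * (pow (- ι 4) k * trinomial (- ι 4) (a - ι k) (n ∸ k))
        ≈ pow (- 1#) n * (binom a k * binom (ι 2 * a - ι 2 * ι k) (n ∸ k) * pow (ι 4) k * cs k)
      closed-form k k≤n = begin
        binom a k * cs k * (pow (- ι 4) k * trinomial (- ι 4) (a - ι k) (n ∸ k))
          ≈⟨ *-congˡ (*-cong pow-[-4] (trinomial-neg4 (n ∸ k) (a - ι k))) ⟩
        binom a k * cs k * (pow (- 1#) k * pow (ι 4) k * (pow (- 1#) (n ∸ k) * binom (ι 2 * (a - ι k)) (n ∸ k)))
          ≈⟨ *-congˡ (*-congˡ (*-congˡ (binom-cong (n ∸ k) 2[a-k]))) ⟩
        binom a k * cs k * (pow (- 1#) k * pow (ι 4) k * (pow (- 1#) (n ∸ k) * binom (ι 2 * a - ι 2 * ι k) (n ∸ k)))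
          ≈⟨ solve 6 (λ A c q f q′ B → A :* c :* (q :* f :* (q′ :* B)) := q :* q′ :* (A :* B :* f :* c)) refl _ _ _ _ _ _ ⟩
        pow (- 1#) k * pow (- 1#) (n ∸ k) * (binom a k * binom (ι 2 * a - ι 2 * ι k) (n ∸ k) * pow (ι 4) k * cs k)
          ≈⟨ *-congʳ (trans (sym (pow-+ (- 1#) k (n ∸ k))) (reflexive (≡.cong (pow (- 1#)) (NP.m+[n∸m]≡n k≤n)))) ⟩
        pow (- 1#) n * (binom a k * binom (ι 2 * a - ι 2 * ι k) (n ∸ k) * pow (ι 4) k * cs k) ∎
        where
        pow-[-4] : pow (- ι 4) k ≈ pow (- 1#) k * pow (ι 4) k
        pow-[-4] = trans (pow-cong k (solve 0 (:- :4 := :- :1 :* :4) refl)) (pow-* (- 1#) (ι 4) k)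
        2[a-k] : ι 2 * (a - ι k) ≈ ι 2 * a - ι 2 * ι k
        2[a-k] = solve 2 (λ a i → :2 :* (a :- i) := :2 :* a :- :2 :* i) refl a (ι k)

    binomialTransform-trinomial-neg2 : ∀ a n →
      sumTo n (λ i → binom a i * binom (ι 2 * a - ι 2 * ι i) (n ∸ i) * pow (- ι 2) i * ds i)
      ≈ sumTo ⌊ n /2⌋ (λ j → binom a (n ∸ j) * binom (ι (n ∸ j)) j * pow (- ι 2) (n ∸ (2 N.* j)) * cs (n ∸ (2 N.* j)))
    binomialTransform-trinomial-neg2 a n = begin
      sumTo n (λ i → binom a i * binom (ι 2 * a - ι 2 * ι i) (n ∸ i) * pow s i * ds i)
        ≈⟨ sumTo-trinomialTransform s a n ⟩
      sumTo n (λ k → binom a k * cs k * (pow s k * trinomial s (a - ι k) (n ∸ k)))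
        ≈⟨ sumTo-reverse n _ ⟩
      sumTo n (λ i → term (n ∸ i) (n ∸ (n ∸ i)))
        ≈⟨ sumTo-cong≤ n (λ i i≤n → reflexive (≡.cong (term (n ∸ i)) (NP.m∸[m∸n]≡n i≤n))) ⟩
      sumTo n (λ i → term (n ∸ i) i)
        ≈⟨ sumTo-evens odd-term n ⟩
      sumTo ⌊ n /2⌋ (λ j → term (n ∸ 2 N.* j) (2 N.* j))
        ≈⟨ sumTo-cong≤ ⌊ n /2⌋ even-term ⟩
      sumTo ⌊ n /2⌋ (λ j → binom a (n ∸ j) * binom (ι (n ∸ j)) j * pow s (n ∸ (2 N.* j)) * cs (n ∸ (2 N.* j))) ∎
      where
      s = - ι 2
      term : ℕ → ℕ → Carrier
      term k m = binom a k * cs k * (pow s k * trinomial s (a - ι k) m)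
      odd-term : ∀ j → term (n ∸ suc (2 N.* j)) (suc (2 N.* j)) ≈ 0#
      odd-term j = trans (*-congˡ (trans (*-congˡ (trinomial-neg2-odd j _)) (zeroʳ _))) (zeroʳ _)
      even-term : ∀ j → j N.≤ ⌊ n /2⌋ →
        term (n ∸ 2 N.* j) (2 N.* j) ≈ binom a (n ∸ j) * binom (ι (n ∸ j)) j * pow s (n ∸ 2 N.* j) * cs (n ∸ 2 N.* j)
      even-term j j≤ = begin
        binom a k * cs k * (pow s k * trinomial s (a - ι k) (2 N.* j))
          ≈⟨ *-congˡ (*-congˡ (trinomial-neg2-even j (a - ι k))) ⟩
        binom a k * cs k * (pow s k * binom (a - ι k) j)
          ≈⟨ solve 4 (λ A c p B → A :* c :* (p :* B) := A :* B :* p :* c) refl _ _ _ _ ⟩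
        binom a k * binom (a - ι k) j * pow s k * cs k
          ≈⟨ *-congʳ (*-congʳ (binom-*-binom-sub a k j)) ⟩
        falling a (k N.+ j) * (invFact k * invFact j) * pow s k * cs k
          ≈⟨ *-congʳ (*-congʳ (*-cong (reflexive (≡.cong (falling a) (NP.+-comm k j))) (*-comm _ _))) ⟩
        falling a (j N.+ k) * (invFact j * invFact k) * pow s k * cs k
          ≈⟨ *-congʳ (*-congʳ (binom-+-*-binom a j k)) ⟨
        binom a (j N.+ k) * binom (ι (j N.+ k)) j * pow s k * cs k
          ≡⟨ ≡.cong (λ i → binom a i * binom (ι i) j * pow s k * cs k) (j+[n∸2j]≡n∸j n j 2j≤n) ⟩
        binom a (n ∸ j) * binom (ι (n ∸ j)) j * pow s k * cs k ∎
        where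
        k = n ∸ 2 N.* j
        2j≤n : 2 N.* j N.≤ n
        2j≤n = NP.≤-trans (NP.*-monoʳ-≤ 2 j≤) (2*⌊n/2⌋≤n n)

theorem7p5 : ∀ {c ℓ} (Q : QAlgebra c ℓ) → let open QOps Q in
    (cs ds : ℕ → Carrier) →
    (∀ n → ds n ≈ sumTo n (λ i → binom (ι n) i * cs i)) →
    ∀ (a b : Carrier) (n : ℕ) →
      (sumTo n (λ i → binom a i * binom b (n ∸ i) * ds i)
        ≈ sumTo n (λ j → binom a j * binom (a + b - ι j) (n ∸ j) * cs j))
    × (sumTo n (λ i → binom a i * binom (ι 2 * a - ι 2 * ι i) (n ∸ i) * pow (- ι 2) i * ds i)
        ≈ sumTo ⌊ n /2⌋ (λ j → binom a (n ∸ j) * binom (ι (n ∸ j)) j * pow (- ι 2) (n ∸ (2 N.* j)) * cs (n ∸ (2 N.* j))))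
    × (sumTo n (λ i → binom a i * binom (ι 2 * a - ι 2 * ι i) (n ∸ i) * pow (- ι 4) i * ds i)
        ≈ pow (- 1#) n * sumTo n (λ j → binom a j * binom (ι 2 * a - ι 2 * ι j) (n ∸ j) * pow (ι 4) j * cs j))
theorem7p5 Q cs ds transform a b n =
    binomialTransform-vandermonde transform a b n
  , binomialTransform-trinomial-neg2 transform a n
  , binomialTransform-trinomial-neg4 transform a n
  where open BinomialSums Q
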